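{- Let $B$ be a finite Boolean algebra and let $\Phi=\{\phi_1,\ldots,\phi_m\}$ be an orthonormal set in $B(n)$. Let $f\in B(n)$ and suppose $\alpha_1,\ldots,\alpha_m\in B(n)$ satisfy $f(X)=\sum_{i=1}^{m}\alpha_i(X)\phi_i(X)$. If the equation $f(X)=0$ is consistent, then the equation $\prod_{i=1}^{m}\alpha_i(X)=0$ is consistent.
   Context: $B(n)$ denotes the Boolean algebra of Boolean functions $f:B^n\to B$, i.e. functions given by Boolean expressions (built with $+$, $\cdot$, complement $'$ and constants from $B$) in $n$ variables $X=(x_1,\ldots,x_n)$. A set $\{\phi_1,\ldots,\phi_m\}\subseteq B(n)$ is orthonormal (ON) of order $m$ if $\phi_i\phi_j=0$ for $i\neq j$ and $\sum_{i=1}^m\phi_i=1$. An equation $g(X)=0$ with $g\in B(n)$ is consistent if there is $Z\in B^n$ with $g(Z)=0$. -}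

module Defs where

open import Level using (Level; _⊔_)
open import Data.Nat using (ℕ; zero; suc)
open import Data.Fin using (Fin; zero; suc)
open import Data.Vec using (Vec; lookup)
open import Data.Product using (Σ; ∃; _×_)
open import Algebra.Lattice.Bundles using (BooleanAlgebra)
open import Relation.Nullary renaming (¬_ to Not)
open import Relation.Binary.PropositionalEquality using (_≡_)

IsFinite : ∀ {c ℓ} → BooleanAlgebra c ℓ → Set (c ⊔ ℓ)
IsFinite B = Σ ℕ λ k → Σ (Fin k → Carrier) λ enum → ∀ x → ∃ λ i → enum i ≈ x
  where open BooleanAlgebra B

module _ {c ℓ} (B : BooleanAlgebra c ℓ) where
  open BooleanAlgebra B

  data BExpr (n : ℕ) : Set c where
    var   : Fin n → BExpr n
    const : Carrier → BExpr n
    _⊕_   : BExpr n → BExpr n → BExpr n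
    _⊙_   : BExpr n → BExpr n → BExpr n
    compl : BExpr n → BExpr n

  eval : ∀ {n} → BExpr n → Vec Carrier n → Carrier
  eval (var i)   X = lookup X i
  eval (const a) X = a
  eval (e ⊕ e')  X = eval e X ∨ eval e' X
  eval (e ⊙ e')  X = eval e X ∧ eval e' X
  eval (compl e) X = ¬ eval e X

  bigJoin : ∀ m → (Fin m → Carrier) → Carrier
  bigJoin zero    a = ⊥
  bigJoin (suc m) a = a zero ∨ bigJoin m (λ i → a (suc i))

  bigMeet : ∀ m → (Fin m → Carrier) → Carrier
  bigMeet zero    a = ⊤
  bigMeet (suc m) a = a zero ∧ bigMeet m (λ i → a (suc i))

  -- orthonormal family φ₁,…,φₘ in B(n) (identities of Boolean functions, pointwise)
  Orthonormal : ∀ {n} m → (Fin m → BExpr n) → Set (c ⊔ ℓ)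
  Orthonormal {n} m φ =
    (∀ (i j : Fin m) → Not (i ≡ j) → ∀ (X : Vec Carrier n) → eval (φ i) X ∧ eval (φ j) X ≈ ⊥)
    × (∀ (X : Vec Carrier n) → bigJoin m (λ i → eval (φ i) X) ≈ ⊤)

  Consistent : ∀ {n} → (Vec Carrier n → Carrier) → Set (c ⊔ ℓ)
  Consistent {n} g = ∃ λ (Z : Vec Carrier n) → g Z ≈ ⊥

-- If f(Z) = 0, then every αᵢ(Z) ∧ φᵢ(Z) vanishes, so the meet M of the αᵢ(Z)
-- satisfies M ∧ φᵢ(Z) = 0 for each i. Joining over i and using Σ φᵢ = 1
-- gives M = 0, i.e. Z itself solves Π αᵢ(X) = 0.
module Submission where

open import Defs
open import Data.Nat using (ℕ; zero; suc)
open import Data.Fin using (Fin; zero; suc)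
open import Data.Vec using (Vec)
open import Data.Product using (_,_)
open import Algebra.Lattice.Bundles using (BooleanAlgebra)
import Algebra.Lattice.Properties.BooleanAlgebra as BooleanAlgebraProperties
import Relation.Binary.Reasoning.Setoid as SetoidReasoning

module BooleanAlgebraLemmas {c ℓ} (B : BooleanAlgebra c ℓ) where
  open BooleanAlgebra B
  open BooleanAlgebraProperties B
  open SetoidReasoning setoid

  x∨y≈⊥⇒x≈⊥ : ∀ {x y} → x ∨ y ≈ ⊥ → x ≈ ⊥
  x∨y≈⊥⇒x≈⊥ {x} {y} x∨y≈⊥ = begin
    x            ≈⟨ ∧-absorbs-∨ x y ⟨
    x ∧ (x ∨ y)  ≈⟨ ∧-congˡ x∨y≈⊥ ⟩
    x ∧ ⊥        ≈⟨ ∧-zeroʳ x ⟩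
    ⊥            ∎

  x∨y≈⊥⇒y≈⊥ : ∀ {x y} → x ∨ y ≈ ⊥ → y ≈ ⊥
  x∨y≈⊥⇒y≈⊥ {x} {y} x∨y≈⊥ = x∨y≈⊥⇒x≈⊥ (trans (∨-comm y x) x∨y≈⊥)

  x∧z≈⊥⇒x∧y∧z≈⊥ : ∀ {x z} y → x ∧ z ≈ ⊥ → (x ∧ y) ∧ z ≈ ⊥
  x∧z≈⊥⇒x∧y∧z≈⊥ {x} {z} y x∧z≈⊥ = begin
    (x ∧ y) ∧ z  ≈⟨ ∧-assoc x y z ⟩
    x ∧ (y ∧ z)  ≈⟨ ∧-congˡ (∧-comm y z) ⟩
    x ∧ (z ∧ y)  ≈⟨ ∧-assoc x z y ⟨
    (x ∧ z) ∧ y  ≈⟨ ∧-congʳ x∧z≈⊥ ⟩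
    ⊥ ∧ y        ≈⟨ ∧-zeroˡ y ⟩
    ⊥            ∎

  y∧z≈⊥⇒x∧y∧z≈⊥ : ∀ x {y z} → y ∧ z ≈ ⊥ → (x ∧ y) ∧ z ≈ ⊥
  y∧z≈⊥⇒x∧y∧z≈⊥ x {y} {z} y∧z≈⊥ = begin
    (x ∧ y) ∧ z  ≈⟨ ∧-assoc x y z ⟩
    x ∧ (y ∧ z)  ≈⟨ ∧-congˡ y∧z≈⊥ ⟩
    x ∧ ⊥        ≈⟨ ∧-zeroʳ x ⟩
    ⊥            ∎

  bigMeet∧bigJoin≈⊥ : ∀ m (a φ : Fin m → Carrier) →
                      bigJoin B m (λ i → a i ∧ φ i) ≈ ⊥ →
                      bigMeet B m a ∧ bigJoin B m φ ≈ ⊥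
  bigMeet∧bigJoin≈⊥ zero    a φ _        = ∧-zeroʳ ⊤
  bigMeet∧bigJoin≈⊥ (suc m) a φ terms≈⊥ = begin
    (a₀ ∧ M) ∧ (φ₀ ∨ J)              ≈⟨ ∧-distribˡ-∨ (a₀ ∧ M) φ₀ J ⟩
    ((a₀ ∧ M) ∧ φ₀) ∨ ((a₀ ∧ M) ∧ J)  ≈⟨ ∨-cong head≈⊥ tail≈⊥ ⟩
    ⊥ ∨ ⊥                            ≈⟨ ∨-identityʳ ⊥ ⟩
    ⊥                                ∎
    where
    a₀ = a zero
    φ₀ = φ zero
    M  = bigMeet B m (λ i → a (suc i))
    J  = bigJoin B m (λ i → φ (suc i))
    head≈⊥ : (a₀ ∧ M) ∧ φ₀ ≈ ⊥
    head≈⊥ = x∧z≈⊥⇒x∧y∧z≈⊥ M (x∨y≈⊥⇒x≈⊥ terms≈⊥)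
    tail≈⊥ : (a₀ ∧ M) ∧ J ≈ ⊥
    tail≈⊥ = y∧z≈⊥⇒x∧y∧z≈⊥ a₀
      (bigMeet∧bigJoin≈⊥ m (λ i → a (suc i)) (λ i → φ (suc i)) (x∨y≈⊥⇒y≈⊥ terms≈⊥))

  bigMeet≈⊥ : ∀ m (a φ : Fin m → Carrier) → bigJoin B m φ ≈ ⊤ →
              bigJoin B m (λ i → a i ∧ φ i) ≈ ⊥ → bigMeet B m a ≈ ⊥
  bigMeet≈⊥ m a φ φ-total terms≈⊥ = begin
    bigMeet B m a                    ≈⟨ ∧-identityʳ _ ⟨
    bigMeet B m a ∧ ⊤                ≈⟨ ∧-congˡ φ-total ⟨
    bigMeet B m a ∧ bigJoin B m φ    ≈⟨ bigMeet∧bigJoin≈⊥ m a φ terms≈⊥ ⟩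
    ⊥                                ∎

mainTheorem1 : ∀ {c ℓ} (B : BooleanAlgebra c ℓ) → IsFinite B →
    ∀ (n m : ℕ) (φ : Fin m → BExpr B n) → Orthonormal B m φ →
    ∀ (f : BExpr B n) (α : Fin m → BExpr B n) →
    (∀ (X : Vec (BooleanAlgebra.Carrier B) n) →
      BooleanAlgebra._≈_ B (eval B f X)
        (bigJoin B m (λ i → BooleanAlgebra._∧_ B (eval B (α i) X) (eval B (φ i) X)))) →
    Consistent B (eval B f) →
    Consistent B (λ X → bigMeet B m (λ i → eval B (α i) X))
mainTheorem1 B _ n m φ (_ , φ-total) f α f≈expansion (Z , fZ≈⊥) =
  Z , bigMeet≈⊥ m (λ i → eval B (α i) Z) (λ i → eval B (φ i) Z)
        (φ-total Z) (trans (sym (f≈expansion Z)) fZ≈⊥)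
  where
  open BooleanAlgebra B using (sym; trans)
  open BooleanAlgebraLemmas B
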